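{- Let $a\ge 1$ and $b\ge 1$ be integers, let $G$ be a simple $(a,b)$-graph, and let $M$ be a matching of $G$. Then $G_M$ is $(4a-3)$-degenerate.
   Context: A graph $G$ is an $(a,b)$-graph if every subgraph $G'$ of $G$ (including $G$) satisfies $|E(G')|\le a|V(G')|-b$. $G_M$ is the (possibly multi-)graph obtained from $G$ by contracting every edge of $M$ (deleting it and identifying its end-vertices). A graph is $d$-degenerate if every subgraph contains a vertex of degree at most $d$ (degrees counted with multiplicity of edges). -}

module Defs where

open import Data.Nat using (ℕ; zero; suc; _+_; _*_; _≤_)
open import Data.Fin using (Fin; zero; suc)
open import Data.Fin.Subset using (Subset; _∈_; _∉_; ∣_∣; Nonempty)
open import Data.Product using (Σ; ∃; _×_; _,_; proj₁; proj₂)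
open import Data.Sum using (_⊎_)
open import Relation.Binary.PropositionalEquality using (_≡_; _≢_)
open import Relation.Nullary using (¬_; Dec; yes; no)
open import Function.Bundles using (_⇔_)
open import Function.Definitions using (Injective; Surjective)
open import Data.Fin using (_≟_)
open import Data.Fin.Subset.Properties using (_∈?_)

-- A finite (multi)graph on the vertex set Fin n: m edges, edge i has
-- end-vertices proj₁ (edge i) and proj₂ (edge i) (orientation irrelevant).
record Graph (n : ℕ) : Set where
  field
    m    : ℕ
    edge : Fin m → Fin n × Fin n
open Graph public

Joins : ∀ {n} (G : Graph n) → Fin (m G) → Fin n → Fin n → Set
Joins G i u v = edge G i ≡ (u , v) ⊎ edge G i ≡ (v , u)

Simple : ∀ {n} → Graph n → Set
Simple G =
  (∀ i → proj₁ (edge G i) ≢ proj₂ (edge G i)) ×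
  (∀ i j → Joins G j (proj₁ (edge G i)) (proj₂ (edge G i)) → i ≡ j)

IsSubgraph : ∀ {n} (G : Graph n) → Subset n → Subset (m G) → Set
IsSubgraph G S F =
  ∀ i → i ∈ F → proj₁ (edge G i) ∈ S × proj₂ (edge G i) ∈ S

-- (a,b)-graph: every (nonempty) subgraph G' has |E(G')| ≤ a|V(G')| - b,
-- written over ℕ as |E(G')| + b ≤ a |V(G')|.
ABGraph : ℕ → ℕ → ∀ {n} → Graph n → Set
ABGraph a b G = ∀ S F → IsSubgraph G S F → Nonempty S → ∣ F ∣ + b ≤ a * ∣ S ∣

∑ : ∀ {k} → (Fin k → ℕ) → ℕ
∑ {zero}  f = 0
∑ {suc k} f = f zero + ∑ (λ i → f (suc i))

[_≟'_] : ∀ {n} → Fin n → Fin n → ℕ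
[ u ≟' v ] with u ≟ v
... | yes _ = 1
... | no  _ = 0

memb : ∀ {k} → Fin k → Subset k → ℕ
memb i F with i ∈? F
... | yes _ = 1
... | no  _ = 0

-- degree of v in the subgraph with edge set F (loops counted twice,
-- parallel edges counted with multiplicity)
degree : ∀ {n} (G : Graph n) → Subset (m G) → Fin n → ℕ
degree G F v =
  ∑ (λ i → memb i F * ([ proj₁ (edge G i) ≟' v ] + [ proj₂ (edge G i) ≟' v ]))

Degenerate : ℕ → ∀ {n} → Graph n → Set
Degenerate d G = ∀ S F → IsSubgraph G S F → Nonempty S →
  ∃ λ v → v ∈ S × degree G F v ≤ d

Matching : ∀ {n} (G : Graph n) → Subset (m G) → Set
Matching G M = ∀ i j → i ∈ M → j ∈ M → i ≢ j → ∀ v →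
  ¬ ((proj₁ (edge G i) ≡ v ⊎ proj₂ (edge G i) ≡ v) ×
     (proj₁ (edge G j) ≡ v ⊎ proj₂ (edge G j) ≡ v))

-- H (on vertex set Fin n') is G_M, via the vertex map π : Fin n → Fin n'
-- (each vertex sent to its class) and the edge map ι : E(H) → E(G) \ M:
--  * π is onto and identifies exactly the two ends of each edge of M;
--  * ι is a bijection from E(H) onto the edges of G not in M;
--  * the H-edge j is the image under π of the G-edge ι j.
IsContraction : ∀ {n n'} (G : Graph n) (M : Subset (m G)) (H : Graph n')
  → (Fin n → Fin n') → (Fin (m H) → Fin (m G)) → Set
IsContraction {n} G M H π ι =
  Surjective _≡_ _≡_ π ×
  (∀ u v → (π u ≡ π v) ⇔ (u ≡ v ⊎ ∃ λ i → i ∈ M × Joins G i u v)) ×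
  Injective _≡_ _≡_ ι ×
  (∀ j → ι j ∉ M) ×
  (∀ i → i ∉ M → ∃ λ j → ι j ≡ i) ×
  (∀ j → edge H j ≡ (π (proj₁ (edge G (ι j))) , π (proj₂ (edge G (ι j)))))

module Submission where

-- Lift a subgraph (S′, F′) of G_M to G: let S be the preimage of S′ and F consist of
-- the preimages of the edges of F′ together with the t matching edges inside S. Then
-- |F| ≥ |F′| + t, |S| ≤ |S′| + t and t ≤ |S′|, so the (a,b)-bound for (S, F) gives
-- |F′| + b ≤ (2a − 1)|S′|: G_M is a (2a − 1, b)-graph. In a (c,b)-graph with b ≥ 1 every
-- subgraph has average degree below 2c, so it is (2c − 1)-degenerate, and 2(2a − 1) − 1
-- = 4a − 3.

open import Defs
open import Level using (Level)
open import Data.Bool.Base using (true; if_then_else_)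
open import Data.Nat.Base using (ℕ; zero; suc; _+_; _*_; _∸_; _≤_; z≤n)
open import Data.Nat.Properties hiding (_≟_)
open import Data.Nat.Tactic.RingSolver using (solve-∀)
open import Algebra.Properties.Semiring.Sum +-*-semiring
  using (sum; sum-cong-≗; sum-remove; sum-replicate-zero; ∑-distrib-+; ∑-comm; *-distribˡ-sum; *-distribʳ-sum)
open import Data.Fin.Base using (Fin; zero; suc; punchIn)
open import Data.Fin.Properties using (_≟_; any?; punchInᵢ≢i)
open import Data.Fin.Subset using (Subset; _∈_; _∉_; ∣_∣; Nonempty; inside; outside)
open import Data.Fin.Subset.Properties using (_∈?_)
open import Data.Vec.Base using ([]; _∷_; tabulate)
open import Data.Vec.Properties using (lookup∘tabulate; []=⇒lookup; lookup⇒[]=)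
open import Data.Product using (∃; _×_; _,_; proj₁; proj₂)
open import Data.Sum using (_⊎_; inj₁; inj₂)
open import Data.Empty using (⊥; ⊥-elim)
open import Function.Base using (_∘_)
open import Function.Bundles using (_⇔_; Equivalence; mk⇔)
open import Function.Definitions using (Injective; Surjective)
open import Relation.Nullary using (Dec; yes; no; does; proof; ¬_; ¬?; _×-dec_; _⊎-dec_)
open import Relation.Nullary.Reflects using (Reflects; invert)
open import Relation.Nullary.Decidable using (dec-true; decidable-stable)
open import Relation.Unary using (Pred; Decidable)
open import Relation.Unary.Properties using (_∩?_; _∪?_; ∁?)
open import Relation.Binary.PropositionalEquality
  using (_≡_; refl; sym; trans; cong; cong₂; subst; module ≡-Reasoning)

private
  variable
    p q r : Level
    A B : Set p
    k l : ℕ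

𝟙 : Dec A → ℕ
𝟙 a? = if does a? then 1 else 0

𝟙-yes : (a? : Dec A) → A → 𝟙 a? ≡ 1
𝟙-yes (yes _) _ = refl
𝟙-yes (no ¬a) a = ⊥-elim (¬a a)

𝟙-no : (a? : Dec A) → ¬ A → 𝟙 a? ≡ 0
𝟙-no (yes a) ¬a = ⊥-elim (¬a a)
𝟙-no (no _)  _  = refl

𝟙-mono : (A → B) → (a? : Dec A) (b? : Dec B) → 𝟙 a? ≤ 𝟙 b?
𝟙-mono A→B (yes a) b? = ≤-reflexive (sym (𝟙-yes b? (A→B a)))
𝟙-mono A→B (no _)  _  = z≤n

𝟙-cong : A ⇔ B → (a? : Dec A) (b? : Dec B) → 𝟙 a? ≡ 𝟙 b?
𝟙-cong A⇔B a? b? =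
  ≤-antisym (𝟙-mono (Equivalence.to A⇔B) a? b?) (𝟙-mono (Equivalence.from A⇔B) b? a?)

𝟙-split : (a? : Dec A) (b? : Dec B) → 𝟙 a? ≡ 𝟙 (a? ×-dec b?) + 𝟙 (a? ×-dec ¬? b?)
𝟙-split (yes _) (yes _) = refl
𝟙-split (yes _) (no _)  = refl
𝟙-split (no _)  (yes _) = refl
𝟙-split (no _)  (no _)  = refl

𝟙-⊎ : ¬ (A × B) → (a? : Dec A) (b? : Dec B) → 𝟙 (a? ⊎-dec b?) ≡ 𝟙 a? + 𝟙 b?
𝟙-⊎ disjoint (yes a) (yes b) = ⊥-elim (disjoint (a , b))
𝟙-⊎ _        (yes _) (no _)  = refl
𝟙-⊎ _        (no _)  (yes _) = refl
𝟙-⊎ _        (no _)  (no _)  = refl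

memb≡𝟙 : (i : Fin k) (F : Subset k) → memb i F ≡ 𝟙 (i ∈? F)
memb≡𝟙 i F with i ∈? F
... | yes _ = refl
... | no  _ = refl

[≟']≡𝟙 : (u v : Fin k) → [ u ≟' v ] ≡ 𝟙 (u ≟ v)
[≟']≡𝟙 u v with u ≟ v
... | yes _ = refl
... | no  _ = refl

∑≡sum : (f : Fin k → ℕ) → ∑ f ≡ sum f
∑≡sum {zero}  f = refl
∑≡sum {suc k} f = cong (f zero +_) (∑≡sum (f ∘ suc))

sum-mono-≤ : {f g : Fin k → ℕ} → (∀ i → f i ≤ g i) → sum f ≤ sum g
sum-mono-≤ {zero}  _   = z≤n
sum-mono-≤ {suc k} f≤g = +-mono-≤ (f≤g zero) (sum-mono-≤ (f≤g ∘ suc))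

term≤sum : (f : Fin k → ℕ) (i : Fin k) → f i ≤ sum f
term≤sum f zero    = m≤m+n (f zero) _
term≤sum f (suc i) = m≤n⇒m≤o+n (f zero) (term≤sum (f ∘ suc) i)

count : {P : Pred (Fin k) p} → Decidable P → ℕ
count P? = sum (λ x → 𝟙 (P? x))

module _ {P : Pred (Fin k) p} {Q : Pred (Fin k) q} (P? : Decidable P) (Q? : Decidable Q) where

  count-cong : (∀ x → P x ⇔ Q x) → count P? ≡ count Q?
  count-cong P⇔Q = sum-cong-≗ (λ x → 𝟙-cong (P⇔Q x) (P? x) (Q? x))

  count-split : count P? ≡ count (P? ∩? Q?) + count (P? ∩? ∁? Q?)
  count-split = begin
    count P?                                                  ≡⟨ sum-cong-≗ (λ x → 𝟙-split (P? x) (Q? x)) ⟩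
    sum (λ x → 𝟙 ((P? ∩? Q?) x) + 𝟙 ((P? ∩? ∁? Q?) x))      ≡⟨ ∑-distrib-+ (𝟙 ∘ (P? ∩? Q?)) (𝟙 ∘ (P? ∩? ∁? Q?)) ⟩
    count (P? ∩? Q?) + count (P? ∩? ∁? Q?)                    ∎
    where open ≡-Reasoning

  count-disjoint-∪ : (∀ {x} → P x → Q x → ⊥) → count (P? ∪? Q?) ≡ count P? + count Q?
  count-disjoint-∪ disjoint =
    trans (sum-cong-≗ (λ x → 𝟙-⊎ (λ (px , qx) → disjoint px qx) (P? x) (Q? x)))
          (∑-distrib-+ (𝟙 ∘ P?) (𝟙 ∘ Q?))

count-singleton : (x : Fin k) → count (x ≟_) ≡ 1
count-singleton {suc k} x = begin
  count (x ≟_)                                ≡⟨ sum-remove {i = x} (𝟙 ∘ (x ≟_)) ⟩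
  𝟙 (x ≟ x) + sum (λ y → 𝟙 (x ≟ punchIn x y)) ≡⟨ cong₂ _+_ (𝟙-yes (x ≟ x) refl) (sum-cong-≗ off-diagonal) ⟩
  1 + sum {k} (λ _ → 0)                       ≡⟨ cong (1 +_) (sum-replicate-zero k) ⟩
  1                                           ∎
  where
  open ≡-Reasoning
  off-diagonal : ∀ y → 𝟙 (x ≟ punchIn x y) ≡ 0
  off-diagonal y = 𝟙-no (x ≟ punchIn x y) (punchInᵢ≢i x y ∘ sym)

module _ {P : Pred (Fin k) p} (P? : Decidable P) where

  𝟙-any≤count : 𝟙 (any? P?) ≤ count P?
  𝟙-any≤count with any? P?
  ... | yes (x , px) = ≤-trans (≤-reflexive (sym (𝟙-yes (P? x) px))) (term≤sum (𝟙 ∘ P?) x)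
  ... | no _         = z≤n

  count-unique : (∀ {x y} → P x → P y → x ≡ y) → count P? ≤ 𝟙 (any? P?)
  count-unique unique with any? P?
  ... | yes (x , px) = begin
    count P?     ≤⟨ sum-mono-≤ (λ y → 𝟙-mono (unique px) (P? y) (x ≟ y)) ⟩
    count (x ≟_) ≡⟨ count-singleton x ⟩
    1            ∎
    where open ≤-Reasoning
  ... | no ∄x = begin
    count P?          ≤⟨ sum-mono-≤ (λ y → ≤-reflexive (𝟙-no (P? y) (λ py → ∄x (y , py)))) ⟩
    sum {k} (λ _ → 0) ≡⟨ sum-replicate-zero k ⟩
    0                 ∎
    where open ≤-Reasoning

module _ {P : Pred (Fin k) p} {Q : Pred (Fin l) q} (P? : Decidable P) (Q? : Decidable Q) where

  -- Double counting of the pairs (x , y) with P x, Q y and R x y.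
  count-≤-injectiveRel : {R : Fin k → Fin l → Set r} (R? : ∀ x y → Dec (R x y)) →
    (∀ {x} → P x → ∃ λ y → Q y × R x y) →
    (∀ {x x′ y} → P x → P x′ → R x y → R x′ y → x ≡ x′) →
    count P? ≤ count Q?
  count-≤-injectiveRel {R = R} R? total injective = begin
    count P?                               ≤⟨ sum-mono-≤ row ⟩
    sum (λ x → sum (λ y → 𝟙 (Link? x y))) ≡⟨ ∑-comm (λ x y → 𝟙 (Link? x y)) ⟩
    sum (λ y → sum (λ x → 𝟙 (Link? x y))) ≤⟨ sum-mono-≤ column ⟩
    count Q?                               ∎
    where
    open ≤-Reasoning
    Link? : ∀ x y → Dec (P x × Q y × R x y)
    Link? x y = P? x ×-dec (Q? y ×-dec R? x y)
    row : ∀ x → 𝟙 (P? x) ≤ count (Link? x)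
    row x = ≤-trans (𝟙-mono (λ px → let (y , qy , rxy) = total px in y , px , qy , rxy) (P? x) (any? (Link? x)))
                    (𝟙-any≤count (Link? x))
    column : ∀ y → count (λ x → Link? x y) ≤ 𝟙 (Q? y)
    column y = ≤-trans (count-unique (λ x → Link? x y) (λ (px , _ , rxy) (px′ , _ , rx′y) → injective px px′ rxy rx′y))
                       (𝟙-mono (λ (_ , _ , qy , _) → qy) (any? (λ x → Link? x y)) (Q? y))

  count-≤-injective : (f : Fin k → Fin l) → (∀ {x} → P x → Q (f x)) →
    (∀ {x x′} → P x → P x′ → f x ≡ f x′ → x ≡ x′) → count P? ≤ count Q?
  count-≤-injective f maps injective = count-≤-injectiveRel (λ x y → f x ≟ y)
    (λ px → _ , maps px , refl) (λ px px′ fx≡y fx′≡y → injective px px′ (trans fx≡y (sym fx′≡y)))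

  count-≤-surjective : (g : Fin l → Fin k) → (∀ {x} → P x → ∃ λ y → Q y × g y ≡ x) → count P? ≤ count Q?
  count-≤-surjective g covers = count-≤-injectiveRel (λ x y → g y ≟ x)
    covers (λ _ _ gy≡x gy≡x′ → trans (sym gy≡x) gy≡x′)

card≡count : (S : Subset k) → ∣ S ∣ ≡ count (_∈? S)
card≡count []            = refl
card≡count (inside ∷ S)  = cong suc (card≡count S)
card≡count (outside ∷ S) = card≡count S

subset : {P : Pred (Fin k) p} → Decidable P → Subset k
subset P? = tabulate (does ∘ P?)

module _ {P : Pred (Fin k) p} (P? : Decidable P) where

  ∈-subset⁺ : ∀ {x} → P x → x ∈ subset P?
  ∈-subset⁺ {x} px = lookup⇒[]= x (subset P?) (trans (lookup∘tabulate (does ∘ P?) x) (dec-true (P? x) px))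

  ∈-subset⁻ : ∀ {x} → x ∈ subset P? → P x
  ∈-subset⁻ {x} x∈ = invert (subst (Reflects (P x)) does≡true (proof (P? x)))
    where
    does≡true : does (P? x) ≡ true
    does≡true = trans (sym (lookup∘tabulate (does ∘ P?) x)) ([]=⇒lookup x∈)

  ∣subset∣≡count : ∣ subset P? ∣ ≡ count P?
  ∣subset∣≡count = trans (card≡count (subset P?))
    (count-cong (_∈? subset P?) P? (λ _ → mk⇔ ∈-subset⁻ ∈-subset⁺))

handshake : ∀ {n} (G : Graph n) (F : Subset (m G)) → sum (degree G F) ≡ 2 * ∣ F ∣
handshake {n} G F = begin
  sum (degree G F)                                           ≡⟨ sum-cong-≗ (λ v → ∑≡sum (incidence v)) ⟩
  sum (λ v → sum (λ i → incidence v i))                      ≡⟨ ∑-comm incidence ⟩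
  sum (λ i → sum (λ v → incidence v i))                      ≡⟨ sum-cong-≗ (λ i → sym (*-distribˡ-sum (memb i F) (ends i))) ⟩
  sum (λ i → memb i F * sum (ends i))                        ≡⟨ sum-cong-≗ (λ i → cong₂ _*_ (memb≡𝟙 i F) (two-ends i)) ⟩
  sum (λ i → 𝟙 (i ∈? F) * 2)                                 ≡⟨ sym (*-distribʳ-sum 2 (𝟙 ∘ (_∈? F))) ⟩
  count (_∈? F) * 2                                          ≡⟨ cong (_* 2) (sym (card≡count F)) ⟩
  ∣ F ∣ * 2                                                  ≡⟨ *-comm ∣ F ∣ 2 ⟩
  2 * ∣ F ∣                                                  ∎
  where
  open ≡-Reasoning
  ends : Fin (m G) → Fin n → ℕ
  ends i v = [ proj₁ (edge G i) ≟' v ] + [ proj₂ (edge G i) ≟' v ]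
  incidence : Fin n → Fin (m G) → ℕ
  incidence v i = memb i F * ends i v
  two-ends : ∀ i → sum (ends i) ≡ 2
  two-ends i = begin
    sum (ends i)                          ≡⟨ sum-cong-≗ (λ v → cong₂ _+_ ([≟']≡𝟙 u₁ v) ([≟']≡𝟙 u₂ v)) ⟩
    sum (λ v → 𝟙 (u₁ ≟ v) + 𝟙 (u₂ ≟ v))   ≡⟨ ∑-distrib-+ (𝟙 ∘ (u₁ ≟_)) (𝟙 ∘ (u₂ ≟_)) ⟩
    count (u₁ ≟_) + count (u₂ ≟_)         ≡⟨ cong₂ _+_ (count-singleton u₁) (count-singleton u₂) ⟩
    2                                     ∎
    where
    u₁ u₂ : Fin n
    u₁ = proj₁ (edge G i)
    u₂ = proj₂ (edge G i)

degree-sum-bound : ∀ {n} (G : Graph n) (S : Subset n) (F : Subset (m G)) {d} →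
  (∀ v → v ∈ S → d ≤ degree G F v) → d * ∣ S ∣ ≤ 2 * ∣ F ∣
degree-sum-bound G S F {d} high = begin
  d * ∣ S ∣                         ≡⟨ cong (d *_) (card≡count S) ⟩
  d * count (_∈? S)                 ≡⟨ *-distribˡ-sum d (𝟙 ∘ (_∈? S)) ⟩
  sum (λ v → d * 𝟙 (v ∈? S))        ≤⟨ sum-mono-≤ bound ⟩
  sum (degree G F)                  ≡⟨ handshake G F ⟩
  2 * ∣ F ∣                         ∎
  where
  open ≤-Reasoning
  bound : ∀ v → d * 𝟙 (v ∈? S) ≤ degree G F v
  bound v with v ∈? S
  ... | yes v∈S = ≤-trans (≤-reflexive (*-identityʳ d)) (high v v∈S)
  ... | no  _   = ≤-trans (≤-reflexive (*-zeroʳ d)) z≤n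

sparse⇒degenerate : ∀ {c b n} (G : Graph n) → 1 ≤ b → ABGraph c b G → Degenerate (2 * c ∸ 1) G
sparse⇒degenerate {c} {b} G 1≤b sparse S F sub nonempty
  with any? (λ v → (v ∈? S) ×-dec (degree G F v ≤? 2 * c ∸ 1))
... | yes low = low
... | no ∄low = ⊥-elim (<-irrefl refl (begin-strict
  2 * ∣ F ∣         <⟨ *-monoʳ-< 2 (m<m+n ∣ F ∣ 1≤b) ⟩
  2 * (∣ F ∣ + b)   ≤⟨ *-monoʳ-≤ 2 (sparse S F sub nonempty) ⟩
  2 * (c * ∣ S ∣)   ≡⟨ sym (*-assoc 2 c ∣ S ∣) ⟩
  2 * c * ∣ S ∣     ≤⟨ degree-sum-bound G S F high ⟩
  2 * ∣ F ∣         ∎))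
  where
  open ≤-Reasoning
  high : ∀ v → v ∈ S → 2 * c ≤ degree G F v
  high v v∈S = ≤-trans (m≤n+m∸n (2 * c) 1) (≰⇒> (λ low → ∄low (v , v∈S , low)))

2*[1+n]∸1≡1+2*n : ∀ n → 2 * suc n ∸ 1 ≡ suc (2 * n)
2*[1+n]∸1≡1+2*n n = cong (_∸ 1) (*-suc 2 n)

2*[2*n∸1]∸1≡4*n∸3 : ∀ n → 2 * (2 * n ∸ 1) ∸ 1 ≡ 4 * n ∸ 3
2*[2*n∸1]∸1≡4*n∸3 zero    = refl
2*[2*n∸1]∸1≡4*n∸3 (suc n) = begin
  2 * (2 * suc n ∸ 1) ∸ 1 ≡⟨ cong (λ c → 2 * c ∸ 1) (2*[1+n]∸1≡1+2*n n) ⟩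
  2 * suc (2 * n) ∸ 1     ≡⟨ 2*[1+n]∸1≡1+2*n (2 * n) ⟩
  suc (2 * (2 * n))       ≡⟨ cong suc (sym (*-assoc 2 2 n)) ⟩
  suc (4 * n)             ≡⟨ cong (_∸ 3) (sym (*-suc 4 n)) ⟩
  4 * suc n ∸ 3           ∎
  where open ≡-Reasoning

contraction-density-bound : ∀ a {b x t f s k} →
  f + b ≤ a * s → x + t ≤ f → s ≤ t + k → t ≤ k → x + b ≤ (2 * a ∸ 1) * k
contraction-density-bound zero {b} {x} {t} f+b≤0 x+t≤f _ _ =
  ≤-trans (+-monoˡ-≤ b (≤-trans (m≤m+n x t) x+t≤f)) f+b≤0
contraction-density-bound (suc a) {b} {x} {t} {f} {s} {k} f+b≤as x+t≤f s≤t+k t≤k =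
  +-cancelˡ-≤ t _ _ (begin
    t + (x + b)             ≡⟨ regroup t x b ⟩
    x + t + b               ≤⟨ +-monoˡ-≤ b x+t≤f ⟩
    f + b                   ≤⟨ f+b≤as ⟩
    suc a * s               ≤⟨ *-monoʳ-≤ (suc a) s≤t+k ⟩
    suc a * (t + k)         ≡⟨ expand a t k ⟩
    t + (k + a * t + a * k) ≤⟨ +-monoʳ-≤ t (+-monoˡ-≤ (a * k) (+-monoʳ-≤ k (*-monoʳ-≤ a t≤k))) ⟩
    t + (k + a * k + a * k) ≡⟨ cong (t +_) (trans (collect a k) (cong (_* k) (sym (2*[1+n]∸1≡1+2*n a)))) ⟩
    t + (2 * suc a ∸ 1) * k ∎)
  where
  open ≤-Reasoning
  regroup : ∀ t x b → t + (x + b) ≡ x + t + b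
  regroup = solve-∀
  expand : ∀ a t k → suc a * (t + k) ≡ t + (k + a * t + a * k)
  expand = solve-∀
  collect : ∀ a k → k + a * k + a * k ≡ suc (2 * a) * k
  collect = solve-∀

module MatchingContraction
  {n} (G : Graph n) (M : Subset (m G)) (matching : Matching G M)
  {n'} (H : Graph n') (π : Fin n → Fin n') (ι : Fin (m H) → Fin (m G))
  (contraction : IsContraction G M H π ι) where

  private
    e₁ e₂ : Fin (m G) → Fin n
    e₁ i = proj₁ (edge G i)
    e₂ i = proj₂ (edge G i)

    End : Fin (m G) → Fin n → Set
    End i v = e₁ i ≡ v ⊎ e₂ i ≡ v

    SecondEnd : Pred (Fin n) _
    SecondEnd u = ∃ λ i → i ∈ M × e₂ i ≡ u

    SecondEnd? : Decidable SecondEnd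
    SecondEnd? u = any? (λ i → (i ∈? M) ×-dec (e₂ i ≟ u))

  π-surjective : Surjective _≡_ _≡_ π
  π-surjective = proj₁ contraction

  π-identifies : ∀ {u v} → π u ≡ π v → u ≡ v ⊎ ∃ λ i → i ∈ M × Joins G i u v
  π-identifies = Equivalence.to (proj₁ (proj₂ contraction) _ _)

  π-ends : ∀ {i} → i ∈ M → π (e₁ i) ≡ π (e₂ i)
  π-ends {i} i∈M = Equivalence.from (proj₁ (proj₂ contraction) _ _) (inj₂ (i , i∈M , inj₁ refl))

  ι-injective : Injective _≡_ _≡_ ι
  ι-injective = proj₁ (proj₂ (proj₂ contraction))

  ι∉M : ∀ j → ι j ∉ M
  ι∉M = proj₁ (proj₂ (proj₂ (proj₂ contraction)))

  edge-ι : ∀ j → edge H j ≡ (π (e₁ (ι j)) , π (e₂ (ι j)))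
  edge-ι = proj₂ (proj₂ (proj₂ (proj₂ (proj₂ contraction))))

  joins-end₁ : ∀ {i u v} → Joins G i u v → End i u
  joins-end₁ (inj₁ i≡uv) = inj₁ (cong proj₁ i≡uv)
  joins-end₁ (inj₂ i≡vu) = inj₂ (cong proj₂ i≡vu)

  joins-end₂ : ∀ {i u v} → Joins G i u v → End i v
  joins-end₂ (inj₁ i≡uv) = inj₂ (cong proj₂ i≡uv)
  joins-end₂ (inj₂ i≡vu) = inj₁ (cong proj₁ i≡vu)

  matched-edge-unique : ∀ {i j v} → i ∈ M → j ∈ M → End i v → End j v → i ≡ j
  matched-edge-unique {i} {j} {v} i∈M j∈M end-i end-j =
    decidable-stable (i ≟ j) (λ i≢j → matching i j i∈M j∈M i≢j v (end-i , end-j))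

  π∘e₁-injectiveOn-M : ∀ {i j} → i ∈ M → j ∈ M → π (e₁ i) ≡ π (e₁ j) → i ≡ j
  π∘e₁-injectiveOn-M i∈M j∈M eq with π-identifies eq
  ... | inj₁ e₁i≡e₁j           = matched-edge-unique i∈M j∈M (inj₁ refl) (inj₁ (sym e₁i≡e₁j))
  ... | inj₂ (l , l∈M , joins) =
    trans (sym (matched-edge-unique l∈M i∈M (joins-end₁ joins) (inj₁ refl)))
          (matched-edge-unique l∈M j∈M (joins-end₂ joins) (inj₁ refl))

  π-injectiveOn-¬SecondEnd : ∀ {u v} → ¬ SecondEnd u → ¬ SecondEnd v → π u ≡ π v → u ≡ v
  π-injectiveOn-¬SecondEnd ¬second-u ¬second-v eq with π-identifies eq
  ... | inj₁ u≡v                         = u≡v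
  ... | inj₂ (i , i∈M , inj₁ i≡uv) = ⊥-elim (¬second-v (i , i∈M , cong proj₂ i≡uv))
  ... | inj₂ (i , i∈M , inj₂ i≡vu) = ⊥-elim (¬second-u (i , i∈M , cong proj₂ i≡vu))

  module Lift (S′ : Subset n') (F′ : Subset (m H)) where

    Matched : Pred (Fin (m G)) _
    Matched i = i ∈ M × π (e₁ i) ∈ S′

    Matched? : Decidable Matched
    Matched? i = (i ∈? M) ×-dec (π (e₁ i) ∈? S′)

    Image : Pred (Fin (m G)) _
    Image i = ∃ λ j → j ∈ F′ × ι j ≡ i

    Image? : Decidable Image
    Image? i = any? (λ j → (j ∈? F′) ×-dec (ι j ≟ i))

    InS? : Decidable (λ u → π u ∈ S′)
    InS? u = π u ∈? S′

    S : Subset n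
    S = subset InS?

    F : Subset (m G)
    F = subset (Image? ∪? Matched?)

    t : ℕ
    t = count Matched?

    lift-subgraph : IsSubgraph H S′ F′ → IsSubgraph G S F
    lift-subgraph sub i i∈F with ∈-subset⁻ (Image? ∪? Matched?) i∈F
    ... | inj₁ (j , j∈F′ , refl) =
      ∈-subset⁺ InS? (subst (_∈ S′) (cong proj₁ (edge-ι j)) (proj₁ (sub j j∈F′))) ,
      ∈-subset⁺ InS? (subst (_∈ S′) (cong proj₂ (edge-ι j)) (proj₂ (sub j j∈F′)))
    ... | inj₂ (i∈M , πe₁∈S′) =
      ∈-subset⁺ InS? πe₁∈S′ , ∈-subset⁺ InS? (subst (_∈ S′) (π-ends i∈M) πe₁∈S′)

    lift-nonempty : Nonempty S′ → Nonempty S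
    lift-nonempty (w , w∈S′) =
      let (u , πu≡w) = π-surjective w in u , ∈-subset⁺ InS? (subst (_∈ S′) (sym (πu≡w refl)) w∈S′)

    ∣F′∣+t≤∣F∣ : ∣ F′ ∣ + t ≤ ∣ F ∣
    ∣F′∣+t≤∣F∣ = begin
      ∣ F′ ∣ + t                     ≡⟨ cong (_+ t) (card≡count F′) ⟩
      count (_∈? F′) + t             ≤⟨ +-monoˡ-≤ t (count-≤-injective (_∈? F′) Image? ι (λ j∈F′ → _ , j∈F′ , refl) (λ _ _ → ι-injective)) ⟩
      count Image? + count Matched?  ≡⟨ sym (count-disjoint-∪ Image? Matched? (λ (j , _ , ιj≡i) (i∈M , _) → ι∉M j (subst (_∈ M) (sym ιj≡i) i∈M))) ⟩
      count (Image? ∪? Matched?)     ≡⟨ sym (∣subset∣≡count (Image? ∪? Matched?)) ⟩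
      ∣ F ∣                          ∎
      where open ≤-Reasoning

    ∣S∣≤t+∣S′∣ : ∣ S ∣ ≤ t + ∣ S′ ∣
    ∣S∣≤t+∣S′∣ = begin
      ∣ S ∣                                                    ≡⟨ ∣subset∣≡count InS? ⟩
      count InS?                                               ≡⟨ count-split InS? SecondEnd? ⟩
      count (InS? ∩? SecondEnd?) + count (InS? ∩? ∁? SecondEnd?) ≤⟨ +-mono-≤ second-ends other-vertices ⟩
      t + count (_∈? S′)                                       ≡⟨ cong (t +_) (sym (card≡count S′)) ⟩
      t + ∣ S′ ∣                                               ∎
      where
      open ≤-Reasoning
      second-ends : count (InS? ∩? SecondEnd?) ≤ t
      second-ends = count-≤-surjective (InS? ∩? SecondEnd?) Matched? e₂
        λ (πu∈S′ , i , i∈M , e₂i≡u) →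
          i , (i∈M , subst (_∈ S′) (sym (trans (π-ends i∈M) (cong π e₂i≡u))) πu∈S′) , e₂i≡u
      other-vertices : count (InS? ∩? ∁? SecondEnd?) ≤ count (_∈? S′)
      other-vertices = count-≤-injective (InS? ∩? ∁? SecondEnd?) (_∈? S′) π proj₁
        (λ (_ , ¬second-u) (_ , ¬second-v) → π-injectiveOn-¬SecondEnd ¬second-u ¬second-v)

    t≤∣S′∣ : t ≤ ∣ S′ ∣
    t≤∣S′∣ = begin
      t                  ≤⟨ count-≤-injective Matched? (_∈? S′) (π ∘ e₁) proj₂ (λ (i∈M , _) (j∈M , _) → π∘e₁-injectiveOn-M i∈M j∈M) ⟩
      count (_∈? S′)     ≡⟨ sym (card≡count S′) ⟩
      ∣ S′ ∣             ∎
      where open ≤-Reasoning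

  contraction-sparse : ∀ {a b} → ABGraph a b G → ABGraph (2 * a ∸ 1) b H
  contraction-sparse {a} sparse S′ F′ sub nonempty =
    contraction-density-bound a (sparse S F (lift-subgraph sub) (lift-nonempty nonempty))
      ∣F′∣+t≤∣F∣ ∣S∣≤t+∣S′∣ t≤∣S′∣
    where open Lift S′ F′

corollary1 : (a b : ℕ) → 1 ≤ a → 1 ≤ b →
    ∀ {n} (G : Graph n) → Simple G → ABGraph a b G →
    (M : Subset (m G)) → Matching G M →
    ∀ {n'} (H : Graph n') (π : Fin n → Fin n') (ι : Fin (m H) → Fin (m G)) →
    IsContraction G M H π ι →
    Degenerate (4 * a ∸ 3) H
corollary1 a b _ 1≤b G _ sparse M matching H π ι contraction =
  subst (λ d → Degenerate d H) (2*[2*n∸1]∸1≡4*n∸3 a)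
    (sparse⇒degenerate {2 * a ∸ 1} H 1≤b
      (MatchingContraction.contraction-sparse G M matching H π ι contraction {a} sparse))
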